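{- For every positive integer $k$ and every positive integer $n$, there is a graph $U_{k,n}$ of pathwidth at most $k^2+k-1$ with at most $n^{k+1}$ vertices that contains every $n$-vertex graph of pathwidth at most $k$ as a subgraph.
   Context: "$U$ contains $H$ as a subgraph" means $U$ has a subgraph isomorphic to $H$. Pathwidth is the usual notion: the minimum, over path-decompositions, of the maximum bag size minus one. -}

module Defs where

open import Data.Nat using (ℕ; _≤_; _+_)
open import Data.Bool using (Bool; true; false)
open import Data.Fin using (Fin)
open import Data.Fin.Subset using (Subset; _∈_; ∣_∣)
open import Data.Product using (Σ; ∃; ∃-syntax; _×_)
open import Function.Definitions using (Injective)
open import Relation.Binary.PropositionalEquality using (_≡_)

record Graph (n : ℕ) : Set where
  field
    adj   : Fin n → Fin n → Bool
    sym   : ∀ x y → adj x y ≡ adj y x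
    irrefl : ∀ x → adj x x ≡ false
open Graph public

_⊆G_ : ∀ {m n} → Graph m → Graph n → Set
_⊆G_ {m} {n} H U =
  Σ (Fin m → Fin n) λ f →
    Injective _≡_ _≡_ f × (∀ x y → adj H x y ≡ true → adj U (f x) (f y) ≡ true)

record PathDecomposition {n : ℕ} (G : Graph n) : Set where
  field
    len   : ℕ
    bag   : Fin len → Subset n
    covers-vertices : ∀ (v : Fin n) → ∃[ i ] (v ∈ bag i)
    covers-edges    : ∀ (x y : Fin n) → adj G x y ≡ true →
                        ∃[ i ] (x ∈ bag i × y ∈ bag i)
    contiguous      : ∀ (v : Fin n) (i j l : Fin len) →
                        i Data.Fin.≤ j → j Data.Fin.≤ l →
                        v ∈ bag i → v ∈ bag l → v ∈ bag j
open PathDecomposition public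

HasWidth≤ : ∀ {n} {G : Graph n} → PathDecomposition G → ℕ → Set
HasWidth≤ D w = ∀ i → ∣ bag D i ∣ ≤ w + 1

Pathwidth≤ : ∀ {n} → Graph n → ℕ → Set
Pathwidth≤ G w = Σ (PathDecomposition G) λ D → HasWidth≤ D w

-- A path decomposition turns each vertex into the interval of bags containing it; these intervals
-- have ply at most k + 1 and adjacent vertices get meeting intervals. So it suffices to find at most
-- n^(k+1) intervals of ply at most k² + k into which every family of n intervals of ply k + 1 embeds
-- injectively, preserving meetings: U is their intersection graph, whose bags are the points.
--
-- Such a universal family is built by induction on k and, inside, on n. Pick a pivot interval s that
-- starts no later than any interval ends and, among the intervals starting before the current cut
-- point b, ends last. Send s to a hub interval [0, T]. The intervals ending inside s have ply at most
-- k, since s is alive wherever they are once points left of s are moved to its start, so they go to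
-- a family for k − 1 and n − 1 placed under the hub. The intervals ending after s go, with cut point
-- end(s) + 1, to the same construction for n − 1 intervals, shifted past T. Those crossing the end of
-- s must still meet s and the intervals under the hub; since intervals starting before the cut point
-- are always sent to intervals starting at 0, it suffices to stretch those back to 0. The hub, the
-- family for k − 1 and the stretched intervals give ply at most k² + k, and the size is
-- n (1 + (n − 1)^(k+1)) ≤ n^(k+2). For k = 1 the same construction from unit intervals works with a
-- single interval stretched only back to T.

module Submission where

open import Defs using (Graph; _⊆G_; PathDecomposition; HasWidth≤; Pathwidth≤)

open import Data.Bool using (true)
open import Data.Empty using (⊥-elim)
open import Data.Fin as Fin using (Fin; zero; suc; toℕ; fromℕ<; _↑ˡ_; _↑ʳ_; splitAt)
open import Data.Fin.Properties as Finₚ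
  using (toℕ<n; toℕ-injective; toℕ-fromℕ<; ↑ˡ-injective; ↑ʳ-injective; splitAt-↑ˡ; splitAt-↑ʳ; splitAt⁻¹-↑ˡ; splitAt⁻¹-↑ʳ)
open import Data.Fin.Subset using (Subset; ∣_∣; ⁅_⁆; _∪_; ⋃; inside; outside) renaming (_∈_ to _∈ₛ_)
open import Data.Fin.Subset.Properties
  using (p⊆q⇒∣p∣≤∣q∣; ∣p∣≤∣x∷p∣; ∣⊥∣≡0; ∣⁅x⁆∣≡1; x∈⁅x⁆; x∈p∪q⁺) renaming (_∈?_ to _∈ₛ?_)
open import Data.List using (List; []; _∷_; length; map; filter; _++_; allFin)
import Data.List.Extrema.Nat as Extrema
import Data.List.Membership.DecPropositional as DecMembership
open import Data.List.Membership.Propositional using (_∈_; lose)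
open import Data.List.Membership.Propositional.Properties
  using (∈-allFin; ∈-map⁺; ∈-map⁻; ∈-filter⁺; ∈-++⁺ˡ; ∈-++⁺ʳ)
open import Data.List.Properties using (length-map; length-++; length-tabulate; filter-notAll)
open import Data.List.Relation.Unary.All as All using (All)
open import Data.List.Relation.Unary.All.Properties using (all-filter)
open import Data.List.Relation.Unary.Any as Any using (here; there; any?)
open import Data.Nat
  using (ℕ; zero; suc; pred; NonZero; _+_; _*_; _^_; _∸_; _⊔_; _≤_; _<_; _≤?_; _<?_; z≤n; s≤s; s≤s⁻¹)
open import Data.Nat.Properties
open import Data.Nat.Tactic.RingSolver using (solve-∀)
open import Data.Product using (Σ; Σ-syntax; ∃; _×_; _,_; proj₁; proj₂)
open import Data.Sum using (inj₁; inj₂; [_,_]′)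
open import Data.Unit using (⊤; tt)
open import Data.Vec as Vec using ([]; _∷_; tabulate)
open import Data.Vec.Properties using (lookup∘tabulate; []=⇒lookup; lookup⇒[]=)
open import Function using (_∘_; id; case_of_)
open import Function.Bundles using (mk⇔)
open import Relation.Binary using (DecidableEquality)
open import Relation.Binary.PropositionalEquality using (_≡_; _≢_; refl; sym; trans; cong; cong₂; subst; ≢-sym)
open import Relation.Nullary using (Dec; yes; no; does; ¬_; ¬?)
open import Relation.Nullary.Decidable using (map′; _×-dec_; dec-true; dec-false; does-⇔)
open import Relation.Unary using (Decidable)

∣p∪q∣≤∣p∣+∣q∣ : ∀ {n} (p q : Subset n) → ∣ p ∪ q ∣ ≤ ∣ p ∣ + ∣ q ∣
∣p∪q∣≤∣p∣+∣q∣ []            []            = z≤n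
∣p∪q∣≤∣p∣+∣q∣ (outside ∷ p) (outside ∷ q) = ∣p∪q∣≤∣p∣+∣q∣ p q
∣p∪q∣≤∣p∣+∣q∣ (outside ∷ p) (inside ∷ q)  =
  ≤-trans (s≤s (∣p∪q∣≤∣p∣+∣q∣ p q)) (≤-reflexive (sym (+-suc ∣ p ∣ ∣ q ∣)))
∣p∪q∣≤∣p∣+∣q∣ (inside ∷ p)  (t ∷ q)       =
  s≤s (≤-trans (∣p∪q∣≤∣p∣+∣q∣ p q) (+-monoʳ-≤ ∣ p ∣ (∣p∣≤∣x∷p∣ t q)))

∣⋃⁅xs⁆∣≤length : ∀ {n} (xs : List (Fin n)) → ∣ ⋃ (map ⁅_⁆ xs) ∣ ≤ length xs
∣⋃⁅xs⁆∣≤length {n} []       = ≤-reflexive (∣⊥∣≡0 n)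
∣⋃⁅xs⁆∣≤length (x ∷ xs) =
  ≤-trans (∣p∪q∣≤∣p∣+∣q∣ ⁅ x ⁆ _) (+-mono-≤ (≤-reflexive (∣⁅x⁆∣≡1 x)) (∣⋃⁅xs⁆∣≤length xs))

∈⇒∈⋃⁅xs⁆ : ∀ {n} {x : Fin n} {xs} → x ∈ xs → x ∈ₛ ⋃ (map ⁅_⁆ xs)
∈⇒∈⋃⁅xs⁆ (here refl) = x∈p∪q⁺ (inj₁ (x∈⁅x⁆ _))
∈⇒∈⋃⁅xs⁆ (there x∈)  = x∈p∪q⁺ (inj₂ (∈⇒∈⋃⁅xs⁆ x∈))

∣p∣≤length : ∀ {n} (p : Subset n) (xs : List (Fin n)) → (∀ {x} → x ∈ₛ p → x ∈ xs) →
             ∣ p ∣ ≤ length xs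
∣p∣≤length p xs p⊆xs = ≤-trans (p⊆q⇒∣p∣≤∣q∣ (∈⇒∈⋃⁅xs⁆ ∘ p⊆xs)) (∣⋃⁅xs⁆∣≤length xs)

elements : ∀ {n} → Subset n → List (Fin n)
elements []            = []
elements (inside ∷ p)  = zero ∷ map suc (elements p)
elements (outside ∷ p) = map suc (elements p)

length-elements : ∀ {n} (p : Subset n) → length (elements p) ≡ ∣ p ∣
length-elements []            = refl
length-elements (inside ∷ p)  = cong suc (trans (length-map suc (elements p)) (length-elements p))
length-elements (outside ∷ p) = trans (length-map suc (elements p)) (length-elements p)

∈-elements : ∀ {n} {x : Fin n} {p} → x ∈ₛ p → x ∈ elements p
∈-elements {p = inside ∷ p}  Vec.here      = here refl
∈-elements {p = inside ∷ p}  (Vec.there x∈) = there (∈-map⁺ suc (∈-elements x∈))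
∈-elements {p = outside ∷ p} (Vec.there x∈) = ∈-map⁺ suc (∈-elements x∈)

record AtMost {A : Set} (n : ℕ) (Q : A → Set) : Set where
  constructor atMost
  field
    witnesses : List A
    few       : length witnesses ≤ n
    complete  : ∀ {x} → Q x → x ∈ witnesses
open AtMost

module _ {A : Set} {Q : A → Set} where

  AtMost-weaken : ∀ {m n} → m ≤ n → AtMost m Q → AtMost n Q
  AtMost-weaken m≤n (atMost xs few complete) = atMost xs (≤-trans few m≤n) complete

  AtMost-⊆ : ∀ {n} {Q′ : A → Set} → (∀ {x} → Q′ x → Q x) → AtMost n Q → AtMost n Q′
  AtMost-⊆ Q′⊆Q (atMost xs few complete) = atMost xs few (complete ∘ Q′⊆Q)

  AtMost-zero : AtMost 0 Q → ∀ {x} → ¬ Q x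
  AtMost-zero (atMost [] _ complete) qx with complete qx
  ... | ()

  AtMost-one : AtMost 1 Q → ∀ {x y} → Q x → Q y → x ≡ y
  AtMost-one (atMost (z ∷ []) _ complete) qx qy with complete qx | complete qy
  ... | here refl | here refl = refl
  AtMost-one (atMost [] _ complete) qx _ with complete qx
  ... | ()
  AtMost-one (atMost (_ ∷ _ ∷ _) (s≤s ()) _) _ _

  decide-∃ : ∀ {n} → Decidable Q → AtMost n Q → Dec (∃ Q)
  decide-∃ Q? (atMost xs _ complete) =
    map′ Any.satisfied (λ (x , qx) → lose (complete qx) qx) (any? Q? xs)

module _ {A : Set} (_≟_ : DecidableEquality A) {Q : A → Set} where

  AtMost-front : ∀ {n x} → AtMost n Q → Q x →
                 Σ[ xs ∈ List A ] length (x ∷ xs) ≤ n × (∀ {y} → Q y → y ∈ x ∷ xs)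
  AtMost-front {n} {x} (atMost ys few complete) qx = zs , short , listed
    where
      zs : List A
      zs = filter (λ y → ¬? (y ≟ x)) ys
      short : length (x ∷ zs) ≤ n
      short = ≤-trans (filter-notAll _ ys (lose (complete qx) λ ¬x≢x → ¬x≢x refl)) few
      listed : ∀ {y} → Q y → y ∈ x ∷ zs
      listed {y} qy with y ≟ x
      ... | yes refl = here refl
      ... | no y≢x   = there (∈-filter⁺ (λ y → ¬? (y ≟ x)) (complete qy) y≢x)

  AtMost-remove : ∀ {n x} → AtMost (suc n) Q → Q x → AtMost n (λ y → Q y × y ≢ x)
  AtMost-remove Q≤ qx with AtMost-front Q≤ qx
  ... | xs , s≤s short , listed = atMost xs short λ (qy , y≢x) → drop-head (listed qy) y≢x
    where
      drop-head : ∀ {y} → y ∈ _ ∷ xs → y ≢ _ → y ∈ xs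
      drop-head (here refl) y≢x = ⊥-elim (y≢x refl)
      drop-head (there y∈)  _   = y∈

module _ {A : Set} (_≟_ : DecidableEquality A) where

  indexOf : A → List A → ℕ
  indexOf x []       = 0
  indexOf x (y ∷ ys) with x ≟ y
  ... | yes _ = 0
  ... | no _  = suc (indexOf x ys)

  indexOf< : ∀ {x ys} → x ∈ ys → indexOf x ys < length ys
  indexOf< {x} {y ∷ ys} x∈ with x ≟ y
  ... | yes _   = s≤s z≤n
  ... | no x≢y = s≤s (indexOf< (Any.tail x≢y x∈))

  indexOf-head : ∀ x ys → indexOf x (x ∷ ys) ≡ 0
  indexOf-head x ys with x ≟ x
  ... | yes _   = refl
  ... | no x≢x = ⊥-elim (x≢x refl)

  indexOf-injective : ∀ {x y ys} → x ∈ ys → y ∈ ys → indexOf x ys ≡ indexOf y ys → x ≡ y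
  indexOf-injective {x} {y} {z ∷ zs} x∈ y∈ eq with x ≟ z | y ≟ z
  indexOf-injective _  _  _  | yes x≡z | yes y≡z = trans x≡z (sym y≡z)
  indexOf-injective _  _  () | yes _   | no _
  indexOf-injective _  _  () | no _    | yes _
  indexOf-injective x∈ y∈ eq | no x≢z  | no y≢z  =
    indexOf-injective (Any.tail x≢z x∈) (Any.tail y≢z y∈) (suc-injective eq)

module _ {A : Set} {Q : A → Set} (Q? : Decidable Q) (f : A → ℕ) (xs : List A) where

  maximal : ∀ {x₀} → Q x₀ → Σ[ y ∈ A ] Q y × (∀ {z} → z ∈ xs → Q z → f z ≤ f y)
  maximal {x₀} qx₀ = y , Extrema.argmax-all f qx₀ (all-filter Q? xs) , bound
    where
      y : A
      y = Extrema.argmax f x₀ (filter Q? xs)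
      bound : ∀ {z} → z ∈ xs → Q z → f z ≤ f y
      bound z∈ qz = All.lookup (Extrema.f[xs]≤f[argmax] x₀ (filter Q? xs)) (∈-filter⁺ Q? z∈ qz)

  minimal : ∀ {x₀} → Q x₀ → Σ[ y ∈ A ] Q y × (∀ {z} → z ∈ xs → Q z → f y ≤ f z)
  minimal {x₀} qx₀ = y , Extrema.argmin-all f qx₀ (all-filter Q? xs) , bound
    where
      y : A
      y = Extrema.argmin f x₀ (filter Q? xs)
      bound : ∀ {z} → z ∈ xs → Q z → f y ≤ f z
      bound z∈ qz = All.lookup (Extrema.f[argmin]≤f[xs] x₀ (filter Q? xs)) (∈-filter⁺ Q? z∈ qz)

-- Intervals, instances and universal systems

record Interval : Set where
  constructor [_,_]
  field
    lo hi : ℕ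
open Interval

infix 4 _∈ᵢ_ _∈ᵢ?_ _meets_ _meets?_

_∈ᵢ_ : ℕ → Interval → Set
x ∈ᵢ i = lo i ≤ x × x ≤ hi i

_∈ᵢ?_ : ∀ x i → Dec (x ∈ᵢ i)
x ∈ᵢ? i = lo i ≤? x ×-dec x ≤? hi i

_meets_ : Interval → Interval → Set
i meets j = lo i ≤ hi j × lo j ≤ hi i

_meets?_ : ∀ i j → Dec (i meets j)
i meets? j = lo i ≤? hi j ×-dec lo j ≤? hi i

meets-sym : ∀ {i j} → i meets j → j meets i
meets-sym (i≤j , j≤i) = j≤i , i≤j

meets-refl : ∀ {i} → lo i ≤ hi i → i meets i
meets-refl proper = proper , proper

common-point : ∀ {i j} → lo i ≤ hi i → lo j ≤ hi j → i meets j → ∃ λ x → x ∈ᵢ i × x ∈ᵢ j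
common-point {i} {j} proper-i proper-j (i≤j , j≤i) with ≤-total (lo i) (lo j)
... | inj₁ i≤j′ = lo j , (i≤j′ , j≤i) , (≤-refl , proper-j)
... | inj₂ j≤i′ = lo i , (≤-refl , proper-i) , (j≤i′ , i≤j)

record Instance (a q p b : ℕ) : Set₁ where
  field
    Active    : Fin a → Set
    active?   : Decidable Active
    interval  : Fin a → Interval
    proper    : ∀ v → lo (interval v) ≤ hi (interval v)
    actives   : AtMost p Active
    ply       : ∀ x → AtMost q (λ v → Active v × x ∈ᵢ interval v)
    ends-late : ∀ {v} → Active v → b ≤ hi (interval v)

  Early : Fin a → Set
  Early v = Active v × lo (interval v) < b

  early? : Decidable Early
  early? v = active? v ×-dec (lo (interval v) <? b)

record System (P s : ℕ) : Set where
  field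
    size span     : ℕ
    interval      : Fin size → Interval
    proper        : ∀ u → lo (interval u) ≤ hi (interval u)
    ends-early    : ∀ u → hi (interval u) < span
    initial       : List (Fin size)
    few-initial   : length initial ≤ s
    initial-lo≡0  : ∀ {u} → u ∈ initial → lo (interval u) ≡ 0
    ply           : ∀ x → AtMost P (λ u → x ∈ᵢ interval u)

-- Early intervals go to initial ones, which start at 0 and can thus be stretched leftwards.
record Embedding {a q p b P s} (I : Instance a q p b) (S : System P s) : Set where
  private
    module I = Instance I
    module S = System S
  field
    image           : ∀ v → I.Active v → Fin S.size
    injective       : ∀ {v w} av aw → image v av ≡ image w aw → v ≡ w
    meets-preserved : ∀ {v w} av aw → I.interval v meets I.interval w →
                      S.interval (image v av) meets S.interval (image w aw)
    early↦initial   : ∀ {v} av → lo (I.interval v) < b → image v av ∈ S.initial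

Universal : ∀ {P s} → System P s → (q p : ℕ) → Set₁
Universal S q p = ∀ {a b} (I : Instance a q p b) → Embedding I S

embed-nothing : ∀ {a q p b P s} {I : Instance a q p b} {S : System P s} →
                (∀ {v} → ¬ Instance.Active I v) → Embedding I S
embed-nothing none = record
  { image = λ _ av → ⊥-elim (none av) ; injective = λ av → ⊥-elim (none av)
  ; meets-preserved = λ av → ⊥-elim (none av) ; early↦initial = λ av → ⊥-elim (none av) }

Instance-weaken : ∀ {a q p p′ b} → p ≤ p′ → Instance a q p b → Instance a q p′ b
Instance-weaken p≤p′ I = record { Instance I ; actives = AtMost-weaken p≤p′ (Instance.actives I) }

Universal-fewer : ∀ {P s q p p′} {S : System P s} → p ≤ p′ → Universal S q p′ → Universal S q p
Universal-fewer p≤p′ U I = record { Embedding (U (Instance-weaken p≤p′ I)) }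

empty : ∀ {P s} → System P s
empty = record
  { size = 0 ; span = 0 ; interval = λ () ; proper = λ () ; ends-early = λ ()
  ; initial = [] ; few-initial = z≤n ; initial-lo≡0 = λ () ; ply = λ _ → atMost [] z≤n λ {} }

empty-universal : ∀ {P s q} → Universal (empty {P} {s}) q 0
empty-universal I = embed-nothing (AtMost-zero (Instance.actives I))

-- Splitting an instance at a pivot

module _ {a q p b} (I : Instance a q p b) where
  open Instance I

  record Pivot : Set where
    field
      pivot               : Fin a
      pivot-active        : Active pivot
      pivot-starts-first  : ∀ {v} → Active v → lo (interval pivot) ≤ hi (interval v)
      early-ends-by-pivot : ∀ {v} → Early v → hi (interval v) ≤ hi (interval pivot)
      pivot-early         : ∀ {v} → Early v → lo (interval pivot) < b

  private
    latest-early : ∀ {u} → Early u → Pivot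
    latest-early eu with maximal early? (hi ∘ interval) (witnesses actives) eu
    ... | s , (as , s<b) , last = record
      { pivot = s ; pivot-active = as
      ; pivot-starts-first = λ av → <⇒≤ (<-≤-trans s<b (ends-late av))
      ; early-ends-by-pivot = λ ev → last (complete actives (proj₁ ev)) ev
      ; pivot-early = λ _ → s<b }

    earliest : ∀ {v} → Active v → (∀ {u} → ¬ Early u) → Pivot
    earliest av none with minimal active? (lo ∘ interval) (witnesses actives) av
    ... | s , as , first = record
      { pivot = s ; pivot-active = as
      ; pivot-starts-first = λ av′ → ≤-trans (first (complete actives av′) av′) (proper _)
      ; early-ends-by-pivot = λ ev → ⊥-elim (none ev)
      ; pivot-early = λ ev → ⊥-elim (none ev) }

  choose-pivot : ∀ {v} → Active v → Pivot
  choose-pivot av with decide-∃ early? (AtMost-⊆ proj₁ actives)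
  ... | yes (_ , eu) = latest-early eu
  ... | no none      = earliest av (λ eu → none (_ , eu))

module Split {a q p b} (I : Instance a (suc q) (suc p) b) (π : Pivot I) where
  open Instance I
  open Pivot π

  e : ℕ
  e = hi (interval pivot)

  Below : Fin a → Set
  Below v = Active v × v ≢ pivot × hi (interval v) ≤ e

  Beyond : Fin a → Set
  Beyond v = Active v × e < hi (interval v)

  data Part (v : Fin a) : Set where
    at-pivot : v ≡ pivot → Part v
    below    : Below v → Part v
    beyond   : Beyond v → Part v

  part : ∀ {v} → Active v → Part v
  part {v} av with v Fin.≟ pivot | hi (interval v) ≤? e
  ... | yes v≡s | _      = at-pivot v≡s
  ... | no v≢s  | yes le = below (av , v≢s , le)
  ... | no _    | no gt  = beyond (av , ≰⇒> gt)

  beyond≢pivot : ∀ {v} → Beyond v → v ≢ pivot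
  beyond≢pivot (_ , e<e) refl = <-irrefl refl e<e

  beyond-not-early : ∀ {v} → Beyond v → ¬ lo (interval v) < b
  beyond-not-early (av , e<h) l<b = <⇒≱ e<h (early-ends-by-pivot (av , l<b))

  others : AtMost p (λ v → Active v × v ≢ pivot)
  others = AtMost-remove Fin._≟_ actives pivot-active

  -- Moving x right to the start of the pivot loses no interval alive at x, and gains the pivot.
  others-alive : ∀ {x} → x ≤ e → AtMost q (λ v → (Active v × v ≢ pivot) × x ∈ᵢ interval v)
  others-alive {x} x≤e = AtMost-⊆ shift (AtMost-remove Fin._≟_ (ply y) (pivot-active , pivot-alive))
    where
      y : ℕ
      y = x ⊔ lo (interval pivot)
      pivot-alive : y ∈ᵢ interval pivot
      pivot-alive = m≤n⊔m x _ , ⊔-lub x≤e (proper pivot)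
      shift : ∀ {v} → (Active v × v ≢ pivot) × x ∈ᵢ interval v →
                      (Active v × y ∈ᵢ interval v) × v ≢ pivot
      shift ((av , v≢s) , (l , h)) = (av , ≤-trans l (m≤m⊔n x _) , ⊔-lub h (pivot-starts-first av)) , v≢s

  below-instance : Instance a q p b
  below-instance = record
    { Active = Below
    ; active? = λ v → active? v ×-dec (¬? (v Fin.≟ pivot) ×-dec (hi (interval v) ≤? e))
    ; interval = interval ; proper = proper
    ; actives = AtMost-⊆ (λ (av , v≢s , _) → av , v≢s) others
    ; ply = below-ply
    ; ends-late = λ (av , _) → ends-late av }
    where
      below-ply : ∀ x → AtMost q (λ v → Below v × x ∈ᵢ interval v)
      below-ply x with x ≤? e
      ... | yes x≤e = AtMost-⊆ (λ ((av , v≢s , _) , alive) → (av , v≢s) , alive) (others-alive x≤e)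
      ... | no x≰e  = atMost [] z≤n (λ ((_ , _ , h≤e) , (_ , x≤h)) → ⊥-elim (x≰e (≤-trans x≤h h≤e)))

  beyond-instance : Instance a (suc q) p (suc e)
  beyond-instance = record
    { Active = Beyond
    ; active? = λ v → active? v ×-dec (e <? hi (interval v))
    ; interval = interval ; proper = proper
    ; actives = AtMost-⊆ (λ rv → proj₁ rv , beyond≢pivot rv) others
    ; ply = λ x → AtMost-⊆ (λ ((av , _) , alive) → av , alive) (ply x)
    ; ends-late = proj₂ }

-- Gluing and chains

-- The hub [0, span W], then W, then R shifted right by B = span W + 1, except that the lowered
-- intervals of R are stretched back to start at d.
module Glue {PW sW PR sR} (W : System PW sW) (R : System PR sR)
            (lowered : List (Fin (System.size R)))
            (lowered-lo≡0 : ∀ {r} → r ∈ lowered → lo (System.interval R r) ≡ 0)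
            (d : ℕ) (d≤span : d ≤ System.span W) where
  private
    module W = System W
    module R = System R
    open DecMembership (Fin._≟_ {R.size}) using (_∈?_)

  B : ℕ
  B = suc W.span

  size : ℕ
  size = suc (W.size + R.size)

  hub : Fin size
  hub = zero

  inW : Fin W.size → Fin size
  inW w = suc (w ↑ˡ R.size)

  inR : Fin R.size → Fin size
  inR r = suc (W.size ↑ʳ r)

  inW-injective : ∀ {w w′} → inW w ≡ inW w′ → w ≡ w′
  inW-injective eq = ↑ˡ-injective R.size _ _ (Finₚ.suc-injective eq)

  inR-injective : ∀ {r r′} → inR r ≡ inR r′ → r ≡ r′
  inR-injective eq = ↑ʳ-injective W.size _ _ (Finₚ.suc-injective eq)

  inW≢inR : ∀ {w r} → inW w ≢ inR r
  inW≢inR {w} {r} eq with trans (sym (splitAt-↑ˡ W.size w R.size))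
                              (trans (cong (splitAt W.size) (Finₚ.suc-injective eq)) (splitAt-↑ʳ W.size R.size r))
  ... | ()

  data View : Fin size → Set where
    hubᵛ : View hub
    inWᵛ : ∀ w → View (inW w)
    inRᵛ : ∀ r → View (inR r)

  view : ∀ u → View u
  view zero = hubᵛ
  view (suc u) with splitAt W.size u in eq
  ... | inj₁ w = subst (View ∘ suc) (splitAt⁻¹-↑ˡ eq) (inWᵛ w)
  ... | inj₂ r = subst (View ∘ suc) (splitAt⁻¹-↑ʳ eq) (inRᵛ r)

  start-from : ∀ {r} → Dec (r ∈ lowered) → ℕ
  start-from     (yes _) = d
  start-from {r} (no _)  = B + lo (R.interval r)

  start : Fin R.size → ℕ
  start r = start-from (r ∈? lowered)

  data StartView (r : Fin R.size) : Set where
    lowered-start : r ∈ lowered → start r ≡ d → StartView r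
    shifted-start : start r ≡ B + lo (R.interval r) → StartView r

  start-view : ∀ r → StartView r
  start-view r with r ∈? lowered in eq
  ... | yes r∈ = lowered-start r∈ (cong start-from eq)
  ... | no _   = shifted-start (cong start-from eq)

  start-lowered : ∀ {r} → r ∈ lowered → start r ≡ d
  start-lowered {r} r∈ with r ∈? lowered
  ... | yes _  = refl
  ... | no r∉ = ⊥-elim (r∉ r∈)

  start≤ : ∀ r → start r ≤ B + lo (R.interval r)
  start≤ r with start-view r
  ... | lowered-start _ eq = subst (_≤ B + _) (sym eq) (≤-trans d≤span (≤-trans (n≤1+n W.span) (m≤m+n B _)))
  ... | shifted-start eq   = ≤-reflexive eq

  interval : Fin size → Interval
  interval zero    = [ 0 , W.span ]
  interval (suc u) = [ W.interval , (λ r → [ start r , B + hi (R.interval r) ]) ]′ (splitAt W.size u)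

  interval-inW : ∀ w → interval (inW w) ≡ W.interval w
  interval-inW w rewrite splitAt-↑ˡ W.size w R.size = refl

  interval-inR : ∀ r → interval (inR r) ≡ [ start r , B + hi (R.interval r) ]
  interval-inR r rewrite splitAt-↑ʳ W.size R.size r = refl

  proper : ∀ u → lo (interval u) ≤ hi (interval u)
  proper u with view u
  ... | hubᵛ = z≤n
  ... | inWᵛ w rewrite interval-inW w = W.proper w
  ... | inRᵛ r rewrite interval-inR r = ≤-trans (start≤ r) (+-monoʳ-≤ B (R.proper r))

  ends-early : ∀ u → hi (interval u) < B + R.span
  ends-early u with view u
  ... | hubᵛ = s≤s (m≤m+n W.span R.span)
  ... | inWᵛ w rewrite interval-inW w = ≤-trans (W.ends-early w) (≤-trans (n≤1+n W.span) (m≤m+n B R.span))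
  ... | inRᵛ r rewrite interval-inR r = +-monoʳ-< B (R.ends-early r)

  initial : List (Fin size)
  initial = hub ∷ map inW W.initial

  initial-lo≡0 : ∀ {u} → u ∈ initial → lo (interval u) ≡ 0
  initial-lo≡0 (here refl) = refl
  initial-lo≡0 (there u∈) with ∈-map⁻ inW u∈
  ... | w , w∈ , refl rewrite interval-inW w = W.initial-lo≡0 w∈

  few-initial : length initial ≤ suc sW
  few-initial = s≤s (≤-trans (≤-reflexive (length-map inW W.initial)) W.few-initial)

  W-ended : ∀ {x} → W.span ≤ x → AtMost 0 (λ w → x ∈ᵢ W.interval w)
  W-ended span≤x = atMost [] z≤n λ (_ , x≤hi) → ⊥-elim (<⇒≱ (≤-<-trans x≤hi (W.ends-early _)) span≤x)

  cover-early : ∀ {x n n′} → x < B → AtMost n (λ w → x ∈ᵢ W.interval w) →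
                AtMost n′ (λ r → r ∈ lowered × d ≤ x) → AtMost (suc (n + n′)) (λ u → x ∈ᵢ interval u)
  cover-early {x} {n} {n′} x<B (atMost ws few-ws complete-ws) (atMost rs few-rs complete-rs) =
    atMost (hub ∷ map inW ws ++ map inR rs) short listed
    where
      short : length (hub ∷ map inW ws ++ map inR rs) ≤ suc (n + n′)
      short = s≤s (≤-trans (≤-reflexive (trans (length-++ (map inW ws))
                                                (cong₂ _+_ (length-map inW ws) (length-map inR rs))))
                           (+-mono-≤ few-ws few-rs))
      listed : ∀ {u} → x ∈ᵢ interval u → u ∈ hub ∷ map inW ws ++ map inR rs
      listed {u} alive with view u
      ... | hubᵛ = here refl
      ... | inWᵛ w rewrite interval-inW w = there (∈-++⁺ˡ (∈-map⁺ inW (complete-ws alive)))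
      ... | inRᵛ r rewrite interval-inR r with start-view r
      ...   | lowered-start r∈ eq =
              there (∈-++⁺ʳ (map inW ws) (∈-map⁺ inR (complete-rs (r∈ , subst (_≤ x) eq (proj₁ alive)))))
      ...   | shifted-start eq    = ⊥-elim (<⇒≱ x<B (≤-trans (m≤m+n B _) (subst (_≤ x) eq (proj₁ alive))))

  cover-late : ∀ {x n} → B ≤ x → AtMost n (λ r → x ∸ B ∈ᵢ R.interval r) →
               AtMost n (λ u → x ∈ᵢ interval u)
  cover-late {x} B≤x (atMost rs few-rs complete-rs) =
    atMost (map inR rs) (≤-trans (≤-reflexive (length-map inR rs)) few-rs) listed
    where
      listed : ∀ {u} → x ∈ᵢ interval u → u ∈ map inR rs
      listed {u} (l , h) with view u
      ... | hubᵛ = ⊥-elim (<⇒≱ (s≤s h) B≤x)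
      ... | inWᵛ w rewrite interval-inW w = ⊥-elim (<⇒≱ (≤-<-trans h (≤-trans (W.ends-early w) (n≤1+n _))) B≤x)
      ... | inRᵛ r rewrite interval-inR r = ∈-map⁺ inR (complete-rs (lo-shifted , m≤n+o⇒m∸n≤o x B h))
        where
          lo-shifted : lo (R.interval r) ≤ x ∸ B
          lo-shifted with start-view r
          ... | lowered-start r∈ _ = subst (_≤ x ∸ B) (sym (lowered-lo≡0 r∈)) z≤n
          ... | shifted-start eq   = m+n≤o⇒m≤o∸n (lo (R.interval r)) (subst (_≤ x) (trans eq (+-comm B _)) l)

  glued : ∀ {P} → (∀ x → AtMost P (λ u → x ∈ᵢ interval u)) → System P (suc sW)
  glued ply = record
    { size = size ; span = B + R.span ; interval = interval ; proper = proper ; ends-early = ends-early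
    ; initial = initial ; few-initial = few-initial ; initial-lo≡0 = initial-lo≡0 ; ply = ply }

  hub-meets-inW : ∀ w → interval hub meets interval (inW w)
  hub-meets-inW w rewrite interval-inW w = z≤n , ≤-trans (W.proper w) (<⇒≤ (W.ends-early w))

  hub-meets-lowered : ∀ {r} → r ∈ lowered → interval hub meets interval (inR r)
  hub-meets-lowered {r} r∈ rewrite interval-inR r | start-lowered r∈ = z≤n , d≤span

  inW-meets-lowered : ∀ {w r} → r ∈ lowered → d ≤ hi (W.interval w) → interval (inW w) meets interval (inR r)
  inW-meets-lowered {w} {r} r∈ d≤hi rewrite interval-inW w | interval-inR r | start-lowered r∈ =
    ≤-trans (W.proper w) (≤-trans (<⇒≤ (W.ends-early w)) (≤-trans (n≤1+n _) (m≤m+n B _))) , d≤hi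

  inW-meets-inW : ∀ {w w′} → W.interval w meets W.interval w′ → interval (inW w) meets interval (inW w′)
  inW-meets-inW {w} {w′} m rewrite interval-inW w | interval-inW w′ = m

  inR-meets-inR : ∀ {r r′} → R.interval r meets R.interval r′ → interval (inR r) meets interval (inR r′)
  inR-meets-inR {r} {r′} (l≤h′ , l′≤h) rewrite interval-inR r | interval-inR r′ =
    ≤-trans (start≤ r) (+-monoʳ-≤ B l≤h′) , ≤-trans (start≤ r′) (+-monoʳ-≤ B l′≤h)

  module Embed {a q p b} (I : Instance a (suc q) (suc p) b) (π : Pivot I)
    (EW : Embedding (Split.below-instance I π) W)
    (ER : Embedding (Split.beyond-instance I π) R)
    (crossing-lowered : ∀ {v} (rv : Split.Beyond I π v) → lo (Instance.interval I v) ≤ Split.e I π →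
                        Embedding.image ER v rv ∈ lowered)
    (below-reaches-d : ∀ {v u} (jv : Split.Below I π v) (ru : Split.Beyond I π u) →
                    Instance.interval I v meets Instance.interval I u → d ≤ hi (W.interval (Embedding.image EW v jv)))
    where
    private
      module I = Instance I
      module EW = Embedding EW
      module ER = Embedding ER
    open Pivot π
    open Split I π

    place : ∀ {v} → Part v → Fin size
    place (at-pivot _) = hub
    place (below jv)   = inW (EW.image _ jv)
    place (beyond rv)  = inR (ER.image _ rv)

    place-pivot : ∀ {v} (x : Part v) → v ≡ pivot → place x ≡ hub
    place-pivot (at-pivot _)          _     = refl
    place-pivot (below (_ , v≢s , _)) v≡s = ⊥-elim (v≢s v≡s)
    place-pivot (beyond rv)           v≡s = ⊥-elim (beyond≢pivot rv v≡s)

    place-injective : ∀ {v w} (x : Part v) (y : Part w) → place x ≡ place y → v ≡ w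
    place-injective (at-pivot refl) (at-pivot refl) _  = refl
    place-injective (at-pivot _)    (below _)       ()
    place-injective (at-pivot _)    (beyond _)      ()
    place-injective (below _)       (at-pivot _)    ()
    place-injective (beyond _)      (at-pivot _)    ()
    place-injective (below jv)      (below jw)      eq = EW.injective jv jw (inW-injective eq)
    place-injective (beyond rv)     (beyond rw)     eq = ER.injective rv rw (inR-injective eq)
    place-injective (below _)       (beyond _)      eq = ⊥-elim (inW≢inR eq)
    place-injective (beyond _)      (below _)       eq = ⊥-elim (inW≢inR (sym eq))

    pivot-meets : ∀ {w} (y : Part w) → I.interval pivot meets I.interval w → interval hub meets interval (place y)
    pivot-meets (at-pivot _) _       = meets-refl z≤n
    pivot-meets (below jw)   _       = hub-meets-inW _
    pivot-meets (beyond rw)  (_ , l) = hub-meets-lowered (crossing-lowered rw l)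

    below-meets-beyond : ∀ {v u} (jv : Below v) (ru : Beyond u) → I.interval v meets I.interval u →
                         interval (place (below jv)) meets interval (place (beyond ru))
    below-meets-beyond jv@(_ , _ , h≤e) ru m@(_ , l≤h) =
      inW-meets-lowered (crossing-lowered ru (≤-trans l≤h h≤e)) (below-reaches-d jv ru m)

    place-meets : ∀ {v w} (x : Part v) (y : Part w) → I.interval v meets I.interval w →
                  interval (place x) meets interval (place y)
    place-meets (at-pivot refl) y               m = pivot-meets y m
    place-meets x               (at-pivot refl) m = meets-sym (pivot-meets x (meets-sym m))
    place-meets (below jv)      (below jw)      m = inW-meets-inW (EW.meets-preserved jv jw m)
    place-meets (beyond rv)     (beyond rw)     m = inR-meets-inR (ER.meets-preserved rv rw m)
    place-meets (below jv)      (beyond ru)     m = below-meets-beyond jv ru m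
    place-meets (beyond rv)     (below jw)      m = meets-sym (below-meets-beyond jw rv (meets-sym m))

    place-early : ∀ {v} (x : Part v) → lo (I.interval v) < b → place x ∈ initial
    place-early (at-pivot _) _   = here refl
    place-early (below jv)   l<b = there (∈-map⁺ inW (EW.early↦initial jv l<b))
    place-early (beyond rv)  l<b = ⊥-elim (beyond-not-early rv l<b)

    embedding : ∀ {P} (ply : ∀ x → AtMost P (λ u → x ∈ᵢ interval u)) → Embedding I (glued ply)
    embedding _ = record
      { image           = λ _ av → place (part av)
      ; injective       = λ av aw → place-injective (part av) (part aw)
      ; meets-preserved = λ av aw → place-meets (part av) (part aw)
      ; early↦initial   = λ av → place-early (part av) }

module Chain {PW sW} (W : System PW sW) where

  -- Left of B a point lies in the hub, in at most PW intervals of W and in the stretched initial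
  -- intervals of R.
  Ply : ℕ
  Ply = suc (PW + suc sW)

  module Step (R : System Ply (suc sW)) where
    open Glue W R (System.initial R) (System.initial-lo≡0 R) 0 z≤n public

    ply : ∀ x → AtMost Ply (λ u → x ∈ᵢ interval u)
    ply x with x <? B
    ... | yes x<B = cover-early x<B (System.ply W x) (atMost (System.initial R) (System.few-initial R) proj₁)
    ... | no x≮B  = cover-late (≮⇒≥ x≮B) (System.ply R (x ∸ B))

  chain : ℕ → System Ply (suc sW)
  chain zero    = empty
  chain (suc p) = Step.glued (chain p) (Step.ply (chain p))

  chain-universal : ∀ {q m} → Universal W q m → ∀ p → p ≤ suc m → Universal (chain p) (suc q) p
  chain-universal UW zero    _  = empty-universal
  chain-universal UW (suc p) p≤ I with decide-∃ (Instance.active? I) (Instance.actives I)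
  ... | no none       = embed-nothing (λ av → none (_ , av))
  ... | yes (_ , av) =
    Step.Embed.embedding (chain p) I π EW ER (λ rv l → Embedding.early↦initial ER rv (s≤s l)) (λ _ _ _ → z≤n)
      (Step.ply (chain p))
    where
      π : Pivot I
      π = choose-pivot I av
      EW : Embedding (Split.below-instance I π) W
      EW = Universal-fewer (s≤s⁻¹ p≤) UW (Split.below-instance I π)
      ER : Embedding (Split.beyond-instance I π) (chain p)
      ER = chain-universal UW p (≤-trans (n≤1+n p) p≤) (Split.beyond-instance I π)

size-chain : ∀ {PW sW} (W : System PW sW) p → System.size (Chain.chain W p) ≡ p * suc (System.size W)
size-chain W zero    = refl
size-chain W (suc p) = cong (suc (System.size W) +_) (size-chain W p)

-- Ply two: caterpillars

lowest : ∀ m → List (Fin m)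
lowest zero    = []
lowest (suc m) = zero ∷ []

lowest-lo≡0 : ∀ {m} {j : Fin m} → j ∈ lowest m → toℕ j ≡ 0
lowest-lo≡0 {suc m} (here refl) = refl

toℕ≡0⇒∈lowest : ∀ {m} (j : Fin m) → toℕ j ≡ 0 → j ∈ lowest m
toℕ≡0⇒∈lowest zero _ = here refl

units : ℕ → System 1 1
units m = record
  { size = m ; span = m ; interval = λ j → [ toℕ j , toℕ j ] ; proper = λ _ → ≤-refl
  ; ends-early = toℕ<n ; initial = lowest m ; few-initial = few-lowest m ; initial-lo≡0 = lowest-lo≡0
  ; ply = ply }
  where
    few-lowest : ∀ m → length (lowest m) ≤ 1
    few-lowest zero    = z≤n
    few-lowest (suc m) = ≤-refl
    ply : ∀ x → AtMost 1 (λ j → x ∈ᵢ [ toℕ j , toℕ j ])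
    ply x with x <? m
    ... | yes x<m = atMost (fromℕ< x<m ∷ []) ≤-refl λ (j≤x , x≤j) →
                      here (toℕ-injective (trans (≤-antisym j≤x x≤j) (sym (toℕ-fromℕ< x<m))))
    ... | no x≮m  = atMost [] z≤n λ (_ , x≤j) → ⊥-elim (x≮m (≤-<-trans x≤j (toℕ<n _)))

module _ {a m b} (I : Instance a 1 m b) where
  open Instance I

  ply-one-disjoint : ∀ {v w} → Active v → Active w → interval v meets interval w → v ≡ w
  ply-one-disjoint av aw m with common-point (proper _) (proper _) m
  ... | x , x∈v , x∈w = AtMost-one (ply x) (av , x∈v) (aw , x∈w)

  early-unique : ∀ {v w} → Early v → Early w → v ≡ w
  early-unique (av , lv<b) (aw , lw<b) =
    AtMost-one (ply b) (av , <⇒≤ lv<b , ends-late av) (aw , <⇒≤ lw<b , ends-late aw)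

  -- The image depends on v only, not on the proof that v is active, as meets-preserved requires.
  by-position : (order : List (Fin a)) → length order ≤ m → (∀ {v} → Active v → v ∈ order) →
                (∀ {v} → Early v → indexOf Fin._≟_ v order ≡ 0) → Embedding I (units m)
  by-position order short listed early-first = record
    { image           = image
    ; injective       = λ av aw eq → indexOf-injective Fin._≟_ (listed av) (listed aw)
                          (trans (sym (toℕ-fromℕ< _)) (trans (cong toℕ eq) (toℕ-fromℕ< _)))
    ; meets-preserved = meets-preserved
    ; early↦initial   = λ av l<b → toℕ≡0⇒∈lowest _ (trans (toℕ-fromℕ< _) (early-first (av , l<b))) }
    where
      image : ∀ v → Active v → Fin m
      image v av = fromℕ< (<-≤-trans (indexOf< Fin._≟_ (listed av)) short)
      meets-preserved : ∀ {v w} av aw → interval v meets interval w →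
                        [ toℕ (image v av) , toℕ (image v av) ] meets [ toℕ (image w aw) , toℕ (image w aw) ]
      meets-preserved av aw m with ply-one-disjoint av aw m
      ... | refl = ≤-refl , ≤-refl

units-universal : ∀ {m} → Universal (units m) 1 m
units-universal I with decide-∃ (Instance.early? I) (AtMost-⊆ proj₁ (Instance.actives I))
... | no none = by-position I (witnesses actives) (few actives) (complete actives) (λ ev → ⊥-elim (none (_ , ev)))
  where open Instance I
... | yes (u , eu) with AtMost-front Fin._≟_ (Instance.actives I) (proj₁ eu)
...   | us , short , listed =
        by-position I (u ∷ us) short listed λ ev → subst (λ v → indexOf Fin._≟_ v (u ∷ us) ≡ 0)
                                                         (early-unique I eu ev) (indexOf-head Fin._≟_ u us)

record Caterpillar : Set where
  field
    system     : System 2 2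
    spine      : List (Fin (System.size system))
    few-spine  : length spine ≤ 1
    spine-lo≡0 : ∀ {u} → u ∈ spine → lo (System.interval system u) ≡ 0

SpineUniversal : Caterpillar → ℕ → Set₁
SpineUniversal C p = ∀ {a b} (I : Instance a 2 p b) → let open Instance I in
  Σ[ E ∈ Embedding I (Caterpillar.system C) ]
    (∀ {v} (av : Active v) → lo (interval v) < b → (∀ {w} → Early w → w ≡ v) →
     Embedding.image E v av ∈ Caterpillar.spine C)

-- For ply two the interval crossing the end of the pivot is unique and meets nothing below the
-- pivot, so a single interval of R, the spine, is stretched, and only back to the end m of the hub.
module Caterpillars (m : ℕ) where

  module Step (C : Caterpillar) where
    open Caterpillar C using (spine; few-spine; spine-lo≡0)
    open Glue (units m) (Caterpillar.system C) spine spine-lo≡0 m ≤-refl public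

    ply : ∀ x → AtMost 2 (λ u → x ∈ᵢ interval u)
    ply x with x <? m | x <? B
    ... | yes x<m | _       = cover-early (≤-trans x<m (n≤1+n m)) (System.ply (units m) x)
                                (atMost [] z≤n λ (_ , m≤x) → ⊥-elim (<⇒≱ x<m m≤x))
    ... | no x≮m  | yes x<B = cover-early x<B (W-ended (≮⇒≥ x≮m)) (atMost spine few-spine proj₁)
    ... | _       | no x≮B  = cover-late (≮⇒≥ x≮B) (System.ply (Caterpillar.system C) (x ∸ B))

    next : Caterpillar
    next = record { system = glued ply ; spine = hub ∷ [] ; few-spine = ≤-refl
                  ; spine-lo≡0 = λ { (here refl) → refl } }

  caterpillar : ℕ → Caterpillar
  caterpillar zero    = record { system = empty ; spine = [] ; few-spine = z≤n ; spine-lo≡0 = λ () }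
  caterpillar (suc p) = Step.next (caterpillar p)

  caterpillar-universal : ∀ p → p ≤ suc m → SpineUniversal (caterpillar p) p
  caterpillar-universal zero _ I =
    embed-nothing (AtMost-zero actives) , λ av → ⊥-elim (AtMost-zero actives av)
    where open Instance I
  caterpillar-universal (suc p) p≤ {b = b} I with decide-∃ (Instance.active? I) (Instance.actives I)
  ... | no none       = embed-nothing (λ av → none (_ , av)) , λ av → ⊥-elim (none (_ , av))
  ... | yes (_ , av) = E.embedding ply , only-early-on-spine
    where
      open Instance I using (Active; Early; interval; proper)
      π : Pivot I
      π = choose-pivot I av
      open Pivot π
      open Split I π
      open Step (caterpillar p) using (hub; ply; module Embed)
      EW : Embedding below-instance (units m)
      EW = Universal-fewer (s≤s⁻¹ p≤) units-universal below-instance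
      IH : SpineUniversal (caterpillar p) p
      IH = caterpillar-universal p (≤-trans (n≤1+n p) p≤)
      ER : Embedding beyond-instance (Caterpillar.system (caterpillar p))
      ER = proj₁ (IH beyond-instance)

      crossing-unique : ∀ {v w} → Beyond v → Beyond w → lo (interval v) ≤ e → lo (interval w) ≤ e → w ≡ v
      crossing-unique (av , e<v) (aw , e<w) lv lw =
        AtMost-one (others-alive ≤-refl) ((aw , beyond≢pivot (aw , e<w)) , lw , <⇒≤ e<w)
                                         ((av , beyond≢pivot (av , e<v)) , lv , <⇒≤ e<v)

      ER-crossing : ∀ {v} (rv : Beyond v) → lo (interval v) ≤ e →
                    Embedding.image ER v rv ∈ Caterpillar.spine (caterpillar p)
      ER-crossing rv lv = proj₂ (IH beyond-instance) rv (s≤s lv) λ (rw , lw) → crossing-unique rv rw lv (s≤s⁻¹ lw)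

      below-misses-beyond : ∀ {v u} → Below v → Beyond u → ¬ interval v meets interval u
      below-misses-beyond (av , v≢s , hv≤e) (au , e<hu) mt with common-point (proper _) (proper _) mt
      ... | x , x∈v , x∈u with AtMost-one (others-alive (≤-trans (proj₂ x∈v) hv≤e))
                                           ((av , v≢s) , x∈v) ((au , beyond≢pivot (au , e<hu)) , x∈u)
      ...   | refl = <⇒≱ e<hu hv≤e

      module E = Embed I π EW ER ER-crossing (λ jv ru mt → ⊥-elim (below-misses-beyond jv ru mt))

      only-early-on-spine : ∀ {v} (av : Active v) → lo (interval v) < b → (∀ {w} → Early w → w ≡ v) →
                            E.place (part av) ∈ hub ∷ []
      only-early-on-spine av l<b only = here (E.place-pivot (part av) (sym (only (pivot-active , pivot-early (av , l<b)))))

size-caterpillar : ∀ m p → System.size (Caterpillar.system (Caterpillars.caterpillar m p)) ≡ p * suc m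
size-caterpillar m zero    = refl
size-caterpillar m (suc p) = cong (suc m +_) (size-caterpillar m p)

plyBound : ℕ → ℕ
plyBound zero    = 2
plyBound (suc j) = suc (plyBound j + suc (suc (suc j)))

plyBound≤ : ∀ j → plyBound j ≤ suc j * suc j + suc j
plyBound≤ zero    = ≤-refl
plyBound≤ (suc j) = begin
  suc (plyBound j + suc (suc (suc j)))                  ≤⟨ s≤s (+-monoˡ-≤ _ (plyBound≤ j)) ⟩
  suc ((suc j * suc j + suc j) + suc (suc (suc j)))     ≤⟨ m≤m+n _ j ⟩
  suc ((suc j * suc j + suc j) + suc (suc (suc j))) + j ≡⟨ step j ⟩
  suc (suc j) * suc (suc j) + suc (suc j)               ∎
  where
    open ≤-Reasoning
    step : ∀ j → suc ((suc j * suc j + suc j) + suc (suc (suc j))) + j ≡ suc (suc j) * suc (suc j) + suc (suc j)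
    step = solve-∀

-- A chain's copies of W only receive intervals below a pivot, so at most n − 1 of them.
universalSystem : (j n : ℕ) → System (plyBound j) (suc (suc j))
universalSystem zero    n = Caterpillar.system (Caterpillars.caterpillar (pred n) n)
universalSystem (suc j) n = Chain.chain (universalSystem j (pred n)) n

n≤1+pred[n] : ∀ n → n ≤ suc (pred n)
n≤1+pred[n] zero    = z≤n
n≤1+pred[n] (suc n) = ≤-refl

universalSystem-universal : ∀ j n → Universal (universalSystem j n) (suc (suc j)) n
universalSystem-universal zero    n I = proj₁ (Caterpillars.caterpillar-universal (pred n) n (n≤1+pred[n] n) I)
universalSystem-universal (suc j) n   =
  Chain.chain-universal (universalSystem j (pred n)) (universalSystem-universal j (pred n)) n (n≤1+pred[n] n)

1+m^[1+e]≤[1+m]^[1+e] : ∀ m e → suc (m ^ suc e) ≤ suc m ^ suc e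
1+m^[1+e]≤[1+m]^[1+e] m e = +-mono-≤ (m^n>0 (suc m) e) (*-monoʳ-≤ m (^-monoˡ-≤ e (n≤1+n m)))

size-universalSystem : ∀ j n → System.size (universalSystem j n) ≤ n ^ (suc j + 1)
size-universalSystem zero    zero    = z≤n
size-universalSystem zero    (suc n) =
  ≤-reflexive (trans (size-caterpillar n (suc n)) (cong (suc n *_) (sym (*-identityʳ (suc n)))))
size-universalSystem (suc j) zero    = z≤n
size-universalSystem (suc j) (suc n) = begin
  System.size (Chain.chain W (suc n)) ≡⟨ size-chain W (suc n) ⟩
  suc n * suc (System.size W)         ≤⟨ *-monoʳ-≤ (suc n) (s≤s (size-universalSystem j n)) ⟩
  suc n * suc (n ^ (suc j + 1))       ≤⟨ *-monoʳ-≤ (suc n) (1+m^[1+e]≤[1+m]^[1+e] n (j + 1)) ⟩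
  suc n * suc n ^ (suc j + 1)         ∎
  where
    open ≤-Reasoning
    W : System (plyBound j) (suc (suc j))
    W = universalSystem j n

-- Intersection graphs and path decompositions

does⇒ : ∀ {B : Set} (b? : Dec B) → does b? ≡ true → B
does⇒ (yes b) _ = b

module _ {P s} (S : System P s) where
  open System S

  Adjacent : Fin size → Fin size → Set
  Adjacent u w = u ≢ w × interval u meets interval w

  adjacent? : ∀ u w → Dec (Adjacent u w)
  adjacent? u w = ¬? (u Fin.≟ w) ×-dec (interval u meets? interval w)

  intersectionGraph : Graph size
  intersectionGraph = record
    { adj    = λ u w → does (adjacent? u w)
    ; sym    = λ u w → does-⇔ (mk⇔ flip flip) (adjacent? u w) (adjacent? w u)
    ; irrefl = λ u → dec-false (adjacent? u u) (λ (u≢u , _) → u≢u refl) }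
    where
      flip : ∀ {u w} → Adjacent u w → Adjacent w u
      flip (u≢w , m) = ≢-sym u≢w , meets-sym m

  bagAt : Fin span → Subset size
  bagAt t = tabulate (λ u → does (toℕ t ∈ᵢ? interval u))

  ∈-bagAt⁺ : ∀ {t u} → toℕ t ∈ᵢ interval u → u ∈ₛ bagAt t
  ∈-bagAt⁺ {t} {u} alive =
    lookup⇒[]= u (bagAt t) (trans (lookup∘tabulate _ u) (dec-true (toℕ t ∈ᵢ? interval u) alive))

  ∈-bagAt⁻ : ∀ {t u} → u ∈ₛ bagAt t → toℕ t ∈ᵢ interval u
  ∈-bagAt⁻ {t} {u} u∈ = does⇒ (toℕ t ∈ᵢ? interval u) (trans (sym (lookup∘tabulate _ u)) ([]=⇒lookup u∈))

  point : ∀ {x} u → x ∈ᵢ interval u → Fin span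
  point u (_ , x≤hi) = fromℕ< (≤-<-trans x≤hi (ends-early u))

  ∈-bag-point : ∀ {x u w} (alive : x ∈ᵢ interval u) → x ∈ᵢ interval w → w ∈ₛ bagAt (point u alive)
  ∈-bag-point alive alive′ = ∈-bagAt⁺ (subst (_∈ᵢ _) (sym (toℕ-fromℕ< _)) alive′)

  decomposition : PathDecomposition intersectionGraph
  decomposition = record
    { len             = span
    ; bag             = bagAt
    ; covers-vertices = λ u → point u (starts u) , ∈-bag-point (starts u) (starts u)
    ; covers-edges    = covers-edges
    ; contiguous      = λ u i j l i≤j j≤l u∈i u∈l →
        ∈-bagAt⁺ (≤-trans (proj₁ (∈-bagAt⁻ u∈i)) i≤j , ≤-trans j≤l (proj₂ (∈-bagAt⁻ u∈l))) }
    where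
      starts : ∀ u → lo (interval u) ∈ᵢ interval u
      starts u = ≤-refl , proper u
      covers-edges : ∀ u w → does (adjacent? u w) ≡ true → ∃ λ t → u ∈ₛ bagAt t × w ∈ₛ bagAt t
      covers-edges u w adj with common-point (proper u) (proper w) (proj₂ (does⇒ (adjacent? u w) adj))
      ... | x , x∈u , x∈w = point u x∈u , ∈-bag-point x∈u x∈u , ∈-bag-point x∈u x∈w

  intersectionGraph-pathwidth : ∀ {w} → P ≤ w + 1 → Pathwidth≤ intersectionGraph w
  intersectionGraph-pathwidth P≤ = decomposition , λ t → ≤-trans (bag-size t) P≤
    where
      bag-size : ∀ t → ∣ bagAt t ∣ ≤ P
      bag-size t = ≤-trans (∣p∣≤length (bagAt t) _ (complete (ply (toℕ t)) ∘ ∈-bagAt⁻)) (few (ply (toℕ t)))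

module FromDecomposition {n k} (H : Graph n) (D : PathDecomposition H) (width : HasWidth≤ D k) where
  open PathDecomposition D

  private
    in-bag? : ∀ v i → Dec (v ∈ₛ bag i)
    in-bag? v i = v ∈ₛ? bag i

    first-bag : ∀ v → Σ[ i ∈ Fin len ] v ∈ₛ bag i ×
                        (∀ {j} → j ∈ allFin len → v ∈ₛ bag j → toℕ i ≤ toℕ j)
    first-bag v = minimal (in-bag? v) toℕ (allFin len) (proj₂ (covers-vertices v))

    last-bag : ∀ v → Σ[ i ∈ Fin len ] v ∈ₛ bag i ×
                       (∀ {j} → j ∈ allFin len → v ∈ₛ bag j → toℕ j ≤ toℕ i)
    last-bag v = maximal (in-bag? v) toℕ (allFin len) (proj₂ (covers-vertices v))

  interval : Fin n → Interval
  interval v = [ toℕ (proj₁ (first-bag v)) , toℕ (proj₁ (last-bag v)) ]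

  first≤ : ∀ {v i} → v ∈ₛ bag i → lo (interval v) ≤ toℕ i
  first≤ {v} {i} v∈ = proj₂ (proj₂ (first-bag v)) (∈-allFin i) v∈

  ≤last : ∀ {v i} → v ∈ₛ bag i → toℕ i ≤ hi (interval v)
  ≤last {v} {i} v∈ = proj₂ (proj₂ (last-bag v)) (∈-allFin i) v∈

  alive⇒in-bag : ∀ {v x} (alive : x ∈ᵢ interval v) →
                 v ∈ₛ bag (fromℕ< (≤-<-trans (proj₂ alive) (toℕ<n _)))
  alive⇒in-bag {v} (l , h) =
    contiguous v _ _ _ (≤-trans l (≤-reflexive (sym (toℕ-fromℕ< _))))
                       (≤-trans (≤-reflexive (toℕ-fromℕ< _)) h)
      (proj₁ (proj₂ (first-bag v))) (proj₁ (proj₂ (last-bag v)))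

  ply : ∀ x → AtMost (suc k) (λ v → ⊤ × x ∈ᵢ interval v)
  ply x with x <? len
  ... | yes x<len = atMost (elements (bag t))
                      (≤-trans (≤-reflexive (length-elements (bag t)))
                               (≤-trans (width t) (≤-reflexive (+-comm k 1))))
                      (λ (_ , alive) → ∈-elements (alive⇒in-bag alive))
    where
      t : Fin len
      t = fromℕ< x<len
  ... | no x≮len  = atMost [] z≤n (λ (_ , alive) → ⊥-elim (x≮len (≤-<-trans (proj₂ alive) (toℕ<n _))))

  representation : Instance n (suc k) n 0
  representation = record
    { Active = λ _ → ⊤ ; active? = λ _ → yes tt ; interval = interval
    ; proper = λ v → ≤last (proj₁ (proj₂ (first-bag v)))
    ; actives = atMost (allFin n) (≤-reflexive (length-tabulate id)) (λ _ → ∈-allFin _)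
    ; ply = ply ; ends-late = λ _ → z≤n }

  edge⇒meets : ∀ {x y} → Graph.adj H x y ≡ true → interval x meets interval y
  edge⇒meets {x} {y} xy with covers-edges x y xy
  ... | i , x∈ , y∈ = ≤-trans (first≤ x∈) (≤last y∈) , ≤-trans (first≤ y∈) (≤last x∈)

  ⊆-intersectionGraph : ∀ {P s} {S : System P s} → Embedding representation S → H ⊆G intersectionGraph S
  ⊆-intersectionGraph {S = S} E = (λ v → image v tt) , (λ eq → injective tt tt eq) , edges
    where
      open Embedding E
      edges : ∀ x y → Graph.adj H x y ≡ true → does (adjacent? S (image x tt) (image y tt)) ≡ true
      edges x y xy = dec-true (adjacent? S _ _) (images-distinct , meets-preserved tt tt (edge⇒meets xy))
        where
          images-distinct : image x tt ≢ image y tt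
          images-distinct eq with injective tt tt eq
          ... | refl = case trans (sym xy) (Graph.irrefl H x) of λ ()

theorem3p5 : ∀ (k n : ℕ) → .{{_ : NonZero k}} → .{{_ : NonZero n}} →
    Σ ℕ λ N → Σ (Graph N) λ U →
      Pathwidth≤ U (k * k + k ∸ 1) × N ≤ n ^ (k + 1) ×
      (∀ (H : Graph n) → Pathwidth≤ H k → H ⊆G U)
theorem3p5 (suc j) n = System.size S , intersectionGraph S , pathwidth , size-universalSystem j n , contains
  where
    S : System (plyBound j) (suc (suc j))
    S = universalSystem j n
    pathwidth : Pathwidth≤ (intersectionGraph S) (suc j * suc j + suc j ∸ 1)
    pathwidth = intersectionGraph-pathwidth S (≤-trans (plyBound≤ j) (≤-reflexive (+-comm 1 _)))
    contains : ∀ H → Pathwidth≤ H (suc j) → H ⊆G intersectionGraph S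
    contains H (D , width) = FromDecomposition.⊆-intersectionGraph H D width (universalSystem-universal j n _)
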